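{- For all integers $0\le r\le n$ and every matroid $\mathsf{M}\in\overline{\mathcal{M}}_{r,n}$, the point $\overline{p}_{\mathsf{M}}$ is a vertex of $\overline{\Omega}_{r,n}$.
   Context: For integers $0\le r\le n$, $\overline{\mathcal{M}}_{r,n}$ is the set of matroids with ground set $[n]=\{1,\dots,n\}$ and rank $r$. The base polytope $\mathscr{P}(\mathsf{M})\subseteq\mathbb{R}^n$ is the convex hull of the $0/1$ indicator vectors of the bases of $\mathsf{M}$; $\mathbf{1}_X$ is the indicator function of $X\subseteq\mathbb{R}^n$. A Schubert matroid is a matroid whose lattice of cyclic flats is a chain; $\overline{\mathcal{S}}_{r,n}\subseteq\overline{\mathcal{M}}_{r,n}$ is the set of Schubert matroids. For each $\mathsf{M}\in\overline{\mathcal{M}}_{r,n}$ there are unique integers $a_{\mathsf{S}}(\mathsf{M})$ ($\mathsf{S}\in\overline{\mathcal{S}}_{r,n}$) with $\mathbf{1}_{\mathscr{P}(\mathsf{M})}=\sum_{\mathsf{S}}a_{\mathsf{S}}(\mathsf{M})\mathbf{1}_{\mathscr{P}(\mathsf{S})}$; let $\overline{p}_{\mathsf{M}}=(a_{\mathsf{S}}(\mathsf{M}))_{\mathsf{S}}\in\mathbb{Z}^{\overline{\mathcal{S}}_{r,n}}$ and $\overline{\Omega}_{r,n}=\operatorname{conv}\{\overline{p}_{\mathsf{M}}:\mathsf{M}\in\overline{\mathcal{M}}_{r,n}\}\subseteq\mathbb{R}^{\overline{\mathcal{S}}_{r,n}}$.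
   Formalization: The weights of the convex combinations excluded by the vertex condition are taken in ℚ, and the indicator identity defining $\overline{p}_{\mathsf{M}}$ is taken at points of ℚ^n rather than of $\mathbb{R}^n$. -}

module Defs where

open import Data.Bool using (Bool; true; false; if_then_else_)
open import Data.Nat as ℕ using (ℕ; zero; suc)
open import Data.Integer as ℤ using (ℤ)
open import Data.Rational as ℚ using (ℚ; 0ℚ; 1ℚ)
open import Data.Fin using (Fin)
open import Data.Fin.Subset
  using (Subset; _∈_; _∉_; _⊆_; _⊂_; _∪_; _∩_; _-_; ⁅_⁆; ∣_∣)
open import Data.Vec using ([]; _∷_)
open import Data.List using (List; []; _∷_; map; concatMap; foldr)
open import Data.Product using (proj₁; proj₂; Σ; ∃; ∃-syntax; _×_; _,_)
open import Data.Sum using (_⊎_)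
open import Data.List.Relation.Unary.All using (All)
open import Relation.Nullary using (¬_)
open import Relation.Binary.PropositionalEquality using (_≡_; _≢_)

allSubsets : (n : ℕ) → List (Subset n)
allSubsets zero    = [] ∷ []
allSubsets (suc n) =
  concatMap (λ s → (false ∷ s) ∷ (true ∷ s) ∷ []) (allSubsets n)

-- A family of subsets of [n] (a candidate set of bases), stored
-- canonically as a binary trie: Fam n ≅ (Subset n → Bool).
Fam : ℕ → Set
Fam zero    = Bool
Fam (suc n) = Fam n × Fam n

memF : {n : ℕ} → Subset n → Fam n → Bool
memF []          b         = b
memF (false ∷ s) (f₀ , f₁) = memF s f₀
memF (true  ∷ s) (f₀ , f₁) = memF s f₁

_∈F_ : {n : ℕ} → Subset n → Fam n → Set
B ∈F F = memF B F ≡ true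

allFams : (n : ℕ) → List (Fam n)
allFams zero    = false ∷ true ∷ []
allFams (suc n) =
  concatMap (λ f₀ → map (λ f₁ → (f₀ , f₁)) (allFams n)) (allFams n)

sumℚ : {A : Set} → List A → (A → ℚ) → ℚ
sumℚ xs f = foldr (λ x acc → f x ℚ.+ acc) 0ℚ xs

sumℤ : {A : Set} → List A → (A → ℤ) → ℤ
sumℤ xs f = foldr (λ x acc → f x ℤ.+ acc) (ℤ.+ 0) xs

toℚ : ℤ → ℚ
toℚ z = z ℚ./ 1

record IsMatroid (r n : ℕ) (F : Fam n) : Set where
  field
    nonempty : ∃[ B ] (B ∈F F)
    rank-r   : ∀ B → B ∈F F → ∣ B ∣ ≡ r
    exchange : ∀ B₁ B₂ (x : Fin n) → B₁ ∈F F → B₂ ∈F F → x ∈ B₁ → x ∉ B₂ →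
               ∃[ y ] (y ∈ B₂ × y ∉ B₁ × (((B₁ - x) ∪ ⁅ y ⁆) ∈F F))

module _ {n : ℕ} (F : Fam n) where

  Independent : Subset n → Set
  Independent I = ∃[ B ] (B ∈F F × I ⊆ B)

  Dependent : Subset n → Set
  Dependent X = ¬ Independent X

  Circuit : Subset n → Set
  Circuit C = Dependent C × (∀ D → D ⊂ C → Independent D)

  IsRank : Subset n → ℕ → Set
  IsRank X k = (∃[ I ] (I ⊆ X × Independent I × ∣ I ∣ ≡ k))
             × (∀ I → I ⊆ X → Independent I → ∣ I ∣ ℕ.≤ k)

  Flat : Subset n → Set
  Flat X = ∀ (e : Fin n) → e ∉ X → ∀ k k' →
           IsRank X k → IsRank (X ∪ ⁅ e ⁆) k' → k ℕ.< k'

  Cyclic : Subset n → Set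
  Cyclic X = ∀ (e : Fin n) → e ∈ X → ∃[ C ] (Circuit C × e ∈ C × C ⊆ X)

  CyclicFlat : Subset n → Set
  CyclicFlat X = Cyclic X × Flat X

IsSchubert : (r n : ℕ) → Fam n → Set
IsSchubert r n S = IsMatroid r n S ×
  (∀ X Y → CyclicFlat S X → CyclicFlat S Y → X ⊆ Y ⊎ Y ⊆ X)

ind : {n : ℕ} → Subset n → Fin n → ℚ
ind B i with Data.Vec.lookup B i
... | true  = 1ℚ
... | false = 0ℚ
  where import Data.Vec

InPoly : {n : ℕ} → Fam n → (Fin n → ℚ) → Set
InPoly {n} F x = ∃[ λ' ]
  ( (∀ B → 0ℚ ℚ.≤ λ' B)
  × (∀ B → memF B F ≡ false → λ' B ≡ 0ℚ)
  × sumℚ (allSubsets n) λ' ≡ 1ℚ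
  × (∀ i → x i ≡ sumℚ (allSubsets n) (λ B → λ' B ℚ.* ind B i)) )

IndVal : {n : ℕ} → Fam n → (Fin n → ℚ) → ℤ → Set
IndVal F x v = (InPoly F x × v ≡ ℤ.+ 1) ⊎ (¬ InPoly F x × v ≡ ℤ.+ 0)

-- c : Fam n → ℤ is the (Schubert) decomposition of M:
--  c is supported on Schubert matroids in M̄_{r,n}, and
--  1_{P(M)} = Σ_S c(S) 1_{P(S)} pointwise.
IsSchubertDecomp : (r n : ℕ) → Fam n → (Fam n → ℤ) → Set
IsSchubertDecomp r n M c =
    (∀ S → c S ≢ ℤ.+ 0 → IsSchubert r n S)
  × (∀ (x : Fin n → ℚ) (vM : ℤ) (vS : Fam n → ℤ) →
       IndVal M x vM → (∀ S → IndVal S x (vS S)) →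
       vM ≡ sumℤ (allFams n) (λ S → c S ℤ.* vS S))

-- Vertices of Ω̄_{r,n} = conv { p̄_M' : M' ∈ M̄_{r,n} }

ConvCombOfOthers : (r n : ℕ) → (Fam n → Fam n → ℤ) → Fam n → Set
ConvCombOfOthers r n p M = Σ (List (ℚ × Fam n)) λ L →
    All (λ tM → IsMatroid r n (proj₂ tM) × 0ℚ ℚ.≤ proj₁ tM
                × ∃[ S ] (p (proj₂ tM) S ≢ p M S)) L
  × sumℚ L proj₁ ≡ 1ℚ
  × (∀ S → sumℚ L (λ tM → proj₁ tM ℚ.* toℚ (p (proj₂ tM) S)) ≡ toℚ (p M S))

IsVertex : (r n : ℕ) → (Fam n → Fam n → ℤ) → Fam n → Set
IsVertex r n p M = ¬ ConvCombOfOthers r n p M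

{-# OPTIONS --safe #-}
module Submission where

-- Evaluate 1_{P(N)} = Σ_S a_S(N) 1_{P(S)} at a 0/1 point e_B.  Since e_B lies in
-- P(N) exactly when B is a basis of N, the linear map v ↦ (B ↦ Σ_S v_S [B ∈ S])
-- sends p̄_N to the 0/1 indicator vector of the bases of N.  A 0/1 vector is an
-- extreme point of the cube: in a convex combination of cube points equal to it,
-- every term of positive weight equals it.  So if p̄_M were a convex combination
-- of points p̄_{M'} ≠ p̄_M, an M' of positive weight would have the same bases as
-- M, i.e. M' = M.  The same extremality, applied coordinatewise, is what shows
-- that e_B ∈ P(N) forces B to be a basis of N.

open import Defs
open import Data.Nat using (ℕ; zero; suc; _≤_)
open import Data.Integer using (ℤ)

open import Function using (_∘_)
open import Data.Bool using (Bool; true; false; not)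
open import Data.Bool.Properties using (¬-not; not-¬; not-injective)
import Data.Bool.Properties as Bool
import Data.Integer as ℤ
import Data.Integer.Properties as ℤ
open import Data.Rational as ℚ using (ℚ; 0ℚ; 1ℚ; _+_; _-_; _*_; _<_; _<?_; fromℚᵘ)
open import Data.Rational.Properties
  using ( fromℚᵘ-cong; fromℚᵘ-toℚᵘ; toℚᵘ-fromℚᵘ; toℚᵘ-homo-+; toℚᵘ-homo-*
        ; +-comm; +-assoc; +-identityˡ; +-identityʳ; +-inverseʳ; +-mono-≤; +-monoʳ-≤
        ; *-assoc; *-identityˡ; *-identityʳ; *-zeroˡ; *-zeroʳ; *-distribˡ-+; *-distribʳ-+
        ; ≤-refl; ≤-antisym; ≮⇒≥; <⇒≢; nonNegative⁻¹ )
open import Data.Rational.Solver using (module +-*-Solver)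
import Data.Rational.Unnormalised as ℚᵘ
import Data.Rational.Unnormalised.Properties as ℚᵘ
open import Data.Fin.Subset using (Subset)
open import Data.Vec using ([]; _∷_; lookup; tabulate)
import Data.Vec.Properties as Vec
open import Data.List using (List; []; _∷_; _++_; concatMap)
open import Data.List.Relation.Unary.All as All using (All; []; _∷_)
open import Data.List.Relation.Unary.All.Properties using (¬Any⇒All¬)
open import Data.List.Relation.Unary.Any using (here; there; any?)
open import Data.List.Membership.Propositional using (_∈_; find)
open import Data.Product using (∃-syntax; _×_; _,_; proj₁; proj₂)
open import Data.Sum using (inj₁; inj₂)
open import Relation.Nullary using (yes; no; does; contradiction)
open import Relation.Nullary.Decidable using (dec-true; dec-false)
open import Relation.Binary.PropositionalEquality
open ≡-Reasoning

fromℚᵘ-+ : ∀ p q → fromℚᵘ (p ℚᵘ.+ q) ≡ fromℚᵘ p + fromℚᵘ q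
fromℚᵘ-+ p q = trans
  (fromℚᵘ-cong (ℚᵘ.≃-sym (ℚᵘ.≃-trans (toℚᵘ-homo-+ (fromℚᵘ p) (fromℚᵘ q))
                                      (ℚᵘ.+-cong (toℚᵘ-fromℚᵘ p) (toℚᵘ-fromℚᵘ q)))))
  (fromℚᵘ-toℚᵘ (fromℚᵘ p + fromℚᵘ q))

fromℚᵘ-* : ∀ p q → fromℚᵘ (p ℚᵘ.* q) ≡ fromℚᵘ p * fromℚᵘ q
fromℚᵘ-* p q = trans
  (fromℚᵘ-cong (ℚᵘ.≃-sym (ℚᵘ.≃-trans (toℚᵘ-homo-* (fromℚᵘ p) (fromℚᵘ q))
                                      (ℚᵘ.*-cong (toℚᵘ-fromℚᵘ p) (toℚᵘ-fromℚᵘ q)))))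
  (fromℚᵘ-toℚᵘ (fromℚᵘ p * fromℚᵘ q))

-- toℚ a is, definitionally, fromℚᵘ (mkℚᵘ a 0).
toℚ-+ : ∀ a b → toℚ (a ℤ.+ b) ≡ toℚ a + toℚ b
toℚ-+ a b = trans
  (fromℚᵘ-cong {ℚᵘ.mkℚᵘ (a ℤ.+ b) 0} {ℚᵘ.mkℚᵘ a 0 ℚᵘ.+ ℚᵘ.mkℚᵘ b 0} (ℚᵘ.*≡* a+b≃))
  (fromℚᵘ-+ (ℚᵘ.mkℚᵘ a 0) (ℚᵘ.mkℚᵘ b 0))
  where
  a+b≃ : (a ℤ.+ b) ℤ.* ℤ.+ 1 ≡ (a ℤ.* ℤ.+ 1 ℤ.+ b ℤ.* ℤ.+ 1) ℤ.* ℤ.+ 1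
  a+b≃ = cong (ℤ._* ℤ.+ 1) (sym (cong₂ ℤ._+_ (ℤ.*-identityʳ a) (ℤ.*-identityʳ b)))

toℚ-* : ∀ a b → toℚ (a ℤ.* b) ≡ toℚ a * toℚ b
toℚ-* a b = trans
  (fromℚᵘ-cong {ℚᵘ.mkℚᵘ (a ℤ.* b) 0} {ℚᵘ.mkℚᵘ a 0 ℚᵘ.* ℚᵘ.mkℚᵘ b 0} (ℚᵘ.*≡* refl))
  (fromℚᵘ-* (ℚᵘ.mkℚᵘ a 0) (ℚᵘ.mkℚᵘ b 0))

nonneg-+-≡0ˡ : ∀ {a b} → 0ℚ ℚ.≤ a → 0ℚ ℚ.≤ b → a + b ≡ 0ℚ → a ≡ 0ℚ
nonneg-+-≡0ˡ {a} 0≤a 0≤b a+b≡0 =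
  ≤-antisym (subst₂ ℚ._≤_ (+-identityʳ a) a+b≡0 (+-monoʳ-≤ a 0≤b)) 0≤a

module _ {A : Set} where

  sumℚ-cong : ∀ (xs : List A) {f g : A → ℚ} → (∀ x → f x ≡ g x) → sumℚ xs f ≡ sumℚ xs g
  sumℚ-cong []       f≗g = refl
  sumℚ-cong (x ∷ xs) f≗g = cong₂ _+_ (f≗g x) (sumℚ-cong xs f≗g)

  sumℚ-congᴬ : ∀ {xs : List A} {f g : A → ℚ} → All (λ x → f x ≡ g x) xs → sumℚ xs f ≡ sumℚ xs g
  sumℚ-congᴬ []            = refl
  sumℚ-congᴬ (fx≡gx ∷ f≗g) = cong₂ _+_ fx≡gx (sumℚ-congᴬ f≗g)

  sumℚ-0 : ∀ (xs : List A) → sumℚ xs (λ _ → 0ℚ) ≡ 0ℚ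
  sumℚ-0 []       = refl
  sumℚ-0 (x ∷ xs) = trans (cong (0ℚ +_) (sumℚ-0 xs)) (+-identityˡ 0ℚ)

  sumℚ-++ : ∀ (xs ys : List A) (f : A → ℚ) → sumℚ (xs ++ ys) f ≡ sumℚ xs f + sumℚ ys f
  sumℚ-++ []       ys f = sym (+-identityˡ (sumℚ ys f))
  sumℚ-++ (x ∷ xs) ys f =
    trans (cong (f x +_) (sumℚ-++ xs ys f)) (sym (+-assoc (f x) (sumℚ xs f) (sumℚ ys f)))

  sumℚ-+ : ∀ (xs : List A) (f g : A → ℚ) → sumℚ xs (λ x → f x + g x) ≡ sumℚ xs f + sumℚ xs g
  sumℚ-+ []       f g = sym (+-identityˡ 0ℚ)
  sumℚ-+ (x ∷ xs) f g = trans (cong (f x + g x +_) (sumℚ-+ xs f g))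
    (solve 4 (λ a b c d → (a :+ b) :+ (c :+ d) := (a :+ c) :+ (b :+ d)) refl
           (f x) (g x) (sumℚ xs f) (sumℚ xs g))
    where open +-*-Solver

  sumℚ-sub : ∀ (xs : List A) (f g : A → ℚ) → sumℚ xs (λ x → f x - g x) ≡ sumℚ xs f - sumℚ xs g
  sumℚ-sub []       f g = refl
  sumℚ-sub (x ∷ xs) f g = trans (cong (f x - g x +_) (sumℚ-sub xs f g))
    (solve 4 (λ a b c d → (a :- b) :+ (c :- d) := (a :+ c) :- (b :+ d)) refl
           (f x) (g x) (sumℚ xs f) (sumℚ xs g))
    where open +-*-Solver

  sumℚ-*ˡ : ∀ (xs : List A) (c : ℚ) (f : A → ℚ) → sumℚ xs (λ x → c * f x) ≡ c * sumℚ xs f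
  sumℚ-*ˡ []       c f = sym (*-zeroʳ c)
  sumℚ-*ˡ (x ∷ xs) c f =
    trans (cong (c * f x +_) (sumℚ-*ˡ xs c f)) (sym (*-distribˡ-+ c (f x) (sumℚ xs f)))

  sumℚ-*ʳ : ∀ (xs : List A) (c : ℚ) (f : A → ℚ) → sumℚ xs (λ x → f x * c) ≡ sumℚ xs f * c
  sumℚ-*ʳ []       c f = sym (*-zeroˡ c)
  sumℚ-*ʳ (x ∷ xs) c f =
    trans (cong (f x * c +_) (sumℚ-*ʳ xs c f)) (sym (*-distribʳ-+ c (f x) (sumℚ xs f)))

  sumℚ-concatMap : ∀ {B : Set} (h : B → List A) (ys : List B) (f : A → ℚ) →
                   sumℚ (concatMap h ys) f ≡ sumℚ ys (λ y → sumℚ (h y) f)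
  sumℚ-concatMap h []       f = refl
  sumℚ-concatMap h (y ∷ ys) f =
    trans (sumℚ-++ (h y) (concatMap h ys) f) (cong (sumℚ (h y) f +_) (sumℚ-concatMap h ys f))

  sumℚ-nonneg : ∀ {xs : List A} {f : A → ℚ} → All (λ x → 0ℚ ℚ.≤ f x) xs → 0ℚ ℚ.≤ sumℚ xs f
  sumℚ-nonneg              []           = ≤-refl
  sumℚ-nonneg {x ∷ xs} {f} (0≤fx ∷ 0≤f) =
    subst (ℚ._≤ f x + sumℚ xs f) (+-identityˡ 0ℚ) (+-mono-≤ 0≤fx (sumℚ-nonneg 0≤f))

  sumℚ-nonneg-≡0 : ∀ {xs : List A} {f : A → ℚ} → All (λ x → 0ℚ ℚ.≤ f x) xs →
                   sumℚ xs f ≡ 0ℚ → ∀ {x} → x ∈ xs → f x ≡ 0ℚ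
  sumℚ-nonneg-≡0 {_ ∷ xs} {f} (0≤fx ∷ 0≤f) Σf≡0 (here refl) =
    nonneg-+-≡0ˡ 0≤fx (sumℚ-nonneg 0≤f) Σf≡0
  sumℚ-nonneg-≡0 {x ∷ xs} {f} (0≤fx ∷ 0≤f) Σf≡0 (there x∈xs) =
    sumℚ-nonneg-≡0 0≤f Σxs≡0 x∈xs
    where
    Σxs≡0 : sumℚ xs f ≡ 0ℚ
    Σxs≡0 = nonneg-+-≡0ˡ (sumℚ-nonneg 0≤f) 0≤fx (trans (+-comm (sumℚ xs f) (f x)) Σf≡0)

  toℚ-sumℤ : ∀ (xs : List A) (f : A → ℤ) → toℚ (sumℤ xs f) ≡ sumℚ xs (toℚ ∘ f)
  toℚ-sumℤ []       f = refl
  toℚ-sumℤ (x ∷ xs) f = trans (toℚ-+ (f x) (sumℤ xs f)) (cong (toℚ (f x) +_) (toℚ-sumℤ xs f))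

sumℚ-swap : ∀ {A B : Set} (xs : List A) (ys : List B) (h : A → B → ℚ) →
            sumℚ xs (λ x → sumℚ ys (h x)) ≡ sumℚ ys (λ y → sumℚ xs (λ x → h x y))
sumℚ-swap []       ys h = sym (sumℚ-0 ys)
sumℚ-swap (x ∷ xs) ys h = trans (cong (sumℚ ys (h x) +_) (sumℚ-swap xs ys h))
  (sym (sumℚ-+ ys (h x) (λ y → sumℚ xs (λ x′ → h x′ y))))

sumℚ-*-pairing : ∀ {A X : Set} (L : List A) (xs : List X) (t : A → ℚ) (v : A → X → ℚ) (w : X → ℚ) →
  sumℚ L (λ y → t y * sumℚ xs (λ S → v y S * w S))
    ≡ sumℚ xs (λ S → sumℚ L (λ y → t y * v y S) * w S)
sumℚ-*-pairing L xs t v w = begin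
  sumℚ L (λ y → t y * sumℚ xs (λ S → v y S * w S))
    ≡⟨ sumℚ-cong L (λ y → sumℚ-*ˡ xs (t y) (λ S → v y S * w S)) ⟨
  sumℚ L (λ y → sumℚ xs (λ S → t y * (v y S * w S)))
    ≡⟨ sumℚ-swap L xs (λ y S → t y * (v y S * w S)) ⟩
  sumℚ xs (λ S → sumℚ L (λ y → t y * (v y S * w S)))
    ≡⟨ sumℚ-cong xs (λ S → sumℚ-cong L (λ y → *-assoc (t y) (v y S) (w S))) ⟨
  sumℚ xs (λ S → sumℚ L (λ y → t y * v y S * w S))
    ≡⟨ sumℚ-cong xs (λ S → sumℚ-*ʳ L (w S) (λ y → t y * v y S)) ⟩
  sumℚ xs (λ S → sumℚ L (λ y → t y * v y S) * w S) ∎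

boolℚ : Bool → ℚ
boolℚ true  = 1ℚ
boolℚ false = 0ℚ

boolℤ : Bool → ℤ
boolℤ true  = ℤ.+ 1
boolℤ false = ℤ.+ 0

toℚ-boolℤ : ∀ b → toℚ (boolℤ b) ≡ boolℚ b
toℚ-boolℤ true  = refl
toℚ-boolℤ false = refl

boolℚ-nonneg : ∀ b → 0ℚ ℚ.≤ boolℚ b
boolℚ-nonneg true  = nonNegative⁻¹ 1ℚ
boolℚ-nonneg false = ≤-refl

*-boolℚ-nonneg : ∀ {q} b → 0ℚ ℚ.≤ q → 0ℚ ℚ.≤ q * boolℚ b
*-boolℚ-nonneg {q} true  0≤q = subst (0ℚ ℚ.≤_) (sym (*-identityʳ q)) 0≤q
*-boolℚ-nonneg {q} false _   = subst (0ℚ ℚ.≤_) (sym (*-zeroʳ q)) ≤-refl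

*-boolℚ-not : ∀ q b → q * boolℚ (not b) ≡ q - q * boolℚ b
*-boolℚ-not q true  = solve 1 (λ q → q :* con 0ℚ := q :- q :* con 1ℚ) refl q where open +-*-Solver
*-boolℚ-not q false = solve 1 (λ q → q :* con 1ℚ := q :- q :* con 0ℚ) refl q where open +-*-Solver

1-boolℚ : ∀ b → 1ℚ - boolℚ b ≡ boolℚ (not b)
1-boolℚ true  = +-inverseʳ 1ℚ
1-boolℚ false = refl

module _ {A : Set} (xs : List A) (t : A → ℚ) where

  positive-weight : All (λ x → 0ℚ ℚ.≤ t x) xs → sumℚ xs t ≡ 1ℚ → ∃[ x ] (x ∈ xs × 0ℚ < t x)
  positive-weight 0≤t Σt≡1 with any? (λ x → 0ℚ <? t x) xs
  ... | yes some = find some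
  ... | no none  = contradiction (trans (sym Σt≡1) (trans (sumℚ-congᴬ t≡0) (sumℚ-0 xs))) λ ()
    where
    t≡0 : All (λ x → t x ≡ 0ℚ) xs
    t≡0 = All.zipWith (λ (t≯0 , 0≤tx) → ≤-antisym (≮⇒≥ t≯0) 0≤tx) (¬Any⇒All¬ xs none , 0≤t)

  sumℚ-*-boolℚ-not : sumℚ xs t ≡ 1ℚ → ∀ (a : A → Bool) c →
                     sumℚ xs (λ x → t x * boolℚ (a x)) ≡ boolℚ c →
                     sumℚ xs (λ x → t x * boolℚ (not (a x))) ≡ boolℚ (not c)
  sumℚ-*-boolℚ-not Σt≡1 a c Σta≡c = begin
    sumℚ xs (λ x → t x * boolℚ (not (a x)))       ≡⟨ sumℚ-cong xs (λ x → *-boolℚ-not (t x) (a x)) ⟩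
    sumℚ xs (λ x → t x - t x * boolℚ (a x))       ≡⟨ sumℚ-sub xs t (λ x → t x * boolℚ (a x)) ⟩
    sumℚ xs t - sumℚ xs (λ x → t x * boolℚ (a x)) ≡⟨ cong₂ _-_ Σt≡1 Σta≡c ⟩
    1ℚ - boolℚ c                                  ≡⟨ 1-boolℚ c ⟩
    boolℚ (not c)                                 ∎

  boolℚ-extremal : All (λ x → 0ℚ ℚ.≤ t x) xs → sumℚ xs t ≡ 1ℚ →
                   ∀ (a : A → Bool) c → sumℚ xs (λ x → t x * boolℚ (a x)) ≡ boolℚ c →
                   ∀ {x} → x ∈ xs → 0ℚ < t x → a x ≡ c
  boolℚ-extremal 0≤t _ a false Σta≡0 {x} x∈xs 0<tx = ¬-not λ ax≡true →
    <⇒≢ 0<tx (sym (trans (sym (*-identityʳ (t x)))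
      (subst (λ b → t x * boolℚ b ≡ 0ℚ) ax≡true
        (sumℚ-nonneg-≡0 (All.map (λ {y} → *-boolℚ-nonneg (a y)) 0≤t) Σta≡0 x∈xs))))
  boolℚ-extremal 0≤t Σt≡1 a true Σta≡1 {x} x∈xs 0<tx = not-injective {a x}
    (boolℚ-extremal 0≤t Σt≡1 (λ y → not (a y)) false (sumℚ-*-boolℚ-not Σt≡1 a true Σta≡1) x∈xs 0<tx)

module _ {n : ℕ} where

  lookup-ext : {B C : Subset n} → (∀ i → lookup B i ≡ lookup C i) → B ≡ C
  lookup-ext {B} {C} B≗C = begin
    B                   ≡⟨ Vec.tabulate∘lookup B ⟨
    tabulate (lookup B) ≡⟨ Vec.tabulate-cong B≗C ⟩
    tabulate (lookup C) ≡⟨ Vec.tabulate∘lookup C ⟩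
    C                   ∎

  ind≡boolℚ : ∀ (B : Subset n) i → ind B i ≡ boolℚ (lookup B i)
  ind≡boolℚ B i with lookup B i
  ... | true  = refl
  ... | false = refl

  pointMass : Subset n → Subset n → ℚ
  pointMass B C = boolℚ (does (Vec.≡-dec Bool._≟_ C B))

  pointMass-self : ∀ B → pointMass B B ≡ 1ℚ
  pointMass-self B = cong boolℚ (dec-true (Vec.≡-dec Bool._≟_ B B) refl)

  pointMass-other : ∀ {B C} → C ≢ B → pointMass B C ≡ 0ℚ
  pointMass-other {B} {C} C≢B = cong boolℚ (dec-false (Vec.≡-dec Bool._≟_ C B) C≢B)

  pointMass-nonneg : ∀ B C → 0ℚ ℚ.≤ pointMass B C
  pointMass-nonneg B C = boolℚ-nonneg (does (Vec.≡-dec Bool._≟_ C B))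

sumℚ-allSubsets-suc : ∀ {n} (f : Subset (suc n) → ℚ) →
  sumℚ (allSubsets (suc n)) f ≡ sumℚ (allSubsets n) (λ s → f (false ∷ s) + f (true ∷ s))
sumℚ-allSubsets-suc {n} f =
  trans (sumℚ-concatMap (λ s → (false ∷ s) ∷ (true ∷ s) ∷ []) (allSubsets n) f)
        (sumℚ-cong (allSubsets n) (λ s → cong (f (false ∷ s) +_) (+-identityʳ (f (true ∷ s)))))

sumℚ-allSubsets-∷ : ∀ {n} b (f : Subset (suc n) → ℚ) → (∀ s → f (not b ∷ s) ≡ 0ℚ) →
                    sumℚ (allSubsets (suc n)) f ≡ sumℚ (allSubsets n) (λ s → f (b ∷ s))
sumℚ-allSubsets-∷ {n} false f f≡0 = trans (sumℚ-allSubsets-suc f) (sumℚ-cong (allSubsets n) λ s →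
  trans (cong (f (false ∷ s) +_) (f≡0 s)) (+-identityʳ (f (false ∷ s))))
sumℚ-allSubsets-∷ {n} true  f f≡0 = trans (sumℚ-allSubsets-suc f) (sumℚ-cong (allSubsets n) λ s →
  trans (cong (_+ f (true ∷ s)) (f≡0 s)) (+-identityˡ (f (true ∷ s))))

sumℚ-allSubsets-point : ∀ {n} (B : Subset n) (f : Subset n → ℚ) → (∀ C → C ≢ B → f C ≡ 0ℚ) →
                        sumℚ (allSubsets n) f ≡ f B
sumℚ-allSubsets-point []      f _   = +-identityʳ (f [])
sumℚ-allSubsets-point (b ∷ B) f f≡0 = trans
  (sumℚ-allSubsets-∷ b f λ s → f≡0 (not b ∷ s) λ e → not-¬ refl (sym (Vec.∷-injectiveˡ e)))
  (sumℚ-allSubsets-point B (λ s → f (b ∷ s)) λ C C≢B → f≡0 (b ∷ C) λ e → C≢B (Vec.∷-injectiveʳ e))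

ind-convex-support : ∀ {n} (B : Subset n) (λ′ : Subset n → ℚ) → (∀ C → 0ℚ ℚ.≤ λ′ C) →
  sumℚ (allSubsets n) λ′ ≡ 1ℚ → (∀ i → ind B i ≡ sumℚ (allSubsets n) (λ C → λ′ C * ind C i)) →
  ∀ {C} → C ∈ allSubsets n → 0ℚ < λ′ C → C ≡ B
ind-convex-support {n} B λ′ 0≤λ′ Σλ′≡1 coordinates C∈ 0<λ′C = lookup-ext λ i →
  boolℚ-extremal (allSubsets n) λ′ (All.tabulate (λ {C} _ → 0≤λ′ C)) Σλ′≡1
    (λ D → lookup D i) (lookup B i) (boolℚ-coordinates i) C∈ 0<λ′C
  where
  boolℚ-coordinates : ∀ i →
    sumℚ (allSubsets n) (λ D → λ′ D * boolℚ (lookup D i)) ≡ boolℚ (lookup B i)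
  boolℚ-coordinates i = begin
    sumℚ (allSubsets n) (λ D → λ′ D * boolℚ (lookup D i))
      ≡⟨ sumℚ-cong (allSubsets n) (λ D → cong (λ′ D *_) (ind≡boolℚ D i)) ⟨
    sumℚ (allSubsets n) (λ D → λ′ D * ind D i) ≡⟨ coordinates i ⟨
    ind B i                                    ≡⟨ ind≡boolℚ B i ⟩
    boolℚ (lookup B i)                         ∎

module _ {n : ℕ} (F : Fam n) where

  ∈F⇒ind∈InPoly : ∀ B → B ∈F F → InPoly F (ind B)
  ∈F⇒ind∈InPoly B B∈F = pointMass B , pointMass-nonneg B , off-F , Σ≡1 , coordinates
    where
    off-F : ∀ C → memF C F ≡ false → pointMass B C ≡ 0ℚ
    off-F C C∉F =
      pointMass-other {B = B} {C = C} λ { refl → contradiction (trans (sym B∈F) C∉F) λ () }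

    Σ≡1 : sumℚ (allSubsets n) (pointMass B) ≡ 1ℚ
    Σ≡1 = trans (sumℚ-allSubsets-point B (pointMass B) (λ _ → pointMass-other)) (pointMass-self B)

    coordinates : ∀ i → ind B i ≡ sumℚ (allSubsets n) (λ C → pointMass B C * ind C i)
    coordinates i = sym (begin
      sumℚ (allSubsets n) (λ C → pointMass B C * ind C i)
        ≡⟨ sumℚ-allSubsets-point B (λ C → pointMass B C * ind C i) (λ C C≢B →
             trans (cong (_* ind C i) (pointMass-other C≢B)) (*-zeroˡ (ind C i))) ⟩
      pointMass B B * ind B i ≡⟨ cong (_* ind B i) (pointMass-self B) ⟩
      1ℚ * ind B i            ≡⟨ *-identityˡ (ind B i) ⟩
      ind B i                 ∎)

  ind∈InPoly⇒∈F : ∀ B → InPoly F (ind B) → B ∈F F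
  ind∈InPoly⇒∈F B (λ′ , 0≤λ′ , off-F , Σλ′≡1 , coordinates) =
    let C , C∈ , 0<λ′C = positive-weight (allSubsets n) λ′ (All.tabulate (λ {C} _ → 0≤λ′ C)) Σλ′≡1
        C∈F = ¬-not λ C∉F → <⇒≢ 0<λ′C (sym (off-F C C∉F))
    in  subst (_∈F F) (ind-convex-support B λ′ 0≤λ′ Σλ′≡1 coordinates C∈ 0<λ′C) C∈F

  indVal-ind : ∀ B → IndVal F (ind B) (boolℤ (memF B F))
  indVal-ind B with memF B F in B∈?F
  ... | true  = inj₁ (∈F⇒ind∈InPoly B B∈?F , refl)
  ... | false =
    inj₂ ((λ ind∈P → contradiction (trans (sym (ind∈InPoly⇒∈F B ind∈P)) B∈?F) λ ()) , refl)

decomposition-at-ind : ∀ {r n} (F : Fam n) {c : Fam n → ℤ} → IsSchubertDecomp r n F c → ∀ B →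
  boolℚ (memF B F) ≡ sumℚ (allFams n) (λ S → toℚ (c S) * boolℚ (memF B S))
decomposition-at-ind {n = n} F {c} (_ , decomp) B = begin
  boolℚ (memF B F)
    ≡⟨ toℚ-boolℤ (memF B F) ⟨
  toℚ (boolℤ (memF B F))
    ≡⟨ cong toℚ (decomp (ind B) _ _ (indVal-ind F B) (λ S → indVal-ind S B)) ⟩
  toℚ (sumℤ (allFams n) (λ S → c S ℤ.* boolℤ (memF B S)))
    ≡⟨ toℚ-sumℤ (allFams n) (λ S → c S ℤ.* boolℤ (memF B S)) ⟩
  sumℚ (allFams n) (λ S → toℚ (c S ℤ.* boolℤ (memF B S)))
    ≡⟨ sumℚ-cong (allFams n) (λ S → trans (toℚ-* (c S) (boolℤ (memF B S)))
                                          (cong (toℚ (c S) *_) (toℚ-boolℤ (memF B S)))) ⟩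
  sumℚ (allFams n) (λ S → toℚ (c S) * boolℚ (memF B S)) ∎

memF-ext : ∀ {n} (F G : Fam n) → (∀ B → memF B F ≡ memF B G) → F ≡ G
memF-ext {zero}  F         G         F≗G = F≗G []
memF-ext {suc n} (F₀ , F₁) (G₀ , G₁) F≗G =
  cong₂ _,_ (memF-ext F₀ G₀ (λ B → F≗G (false ∷ B))) (memF-ext F₁ G₁ (λ B → F≗G (true ∷ B)))

bases-of-combination : ∀ {r n} (p : Fam n → Fam n → ℤ) →
  (∀ M → IsMatroid r n M → IsSchubertDecomp r n M (p M)) →
  ∀ {M} → IsMatroid r n M → (L : List (ℚ × Fam n)) → All (IsMatroid r n ∘ proj₂) L →
  (∀ S → sumℚ L (λ y → proj₁ y * toℚ (p (proj₂ y) S)) ≡ toℚ (p M S)) →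
  ∀ B → sumℚ L (λ y → proj₁ y * boolℚ (memF B (proj₂ y))) ≡ boolℚ (memF B M)
bases-of-combination {n = n} p decomp {M} M-matroid L matroids Σtp≡p B = begin
  sumℚ L (λ y → proj₁ y * boolℚ (memF B (proj₂ y)))
    ≡⟨ sumℚ-congᴬ (All.map (λ {y} M′-matroid → cong (proj₁ y *_)
         (decomposition-at-ind (proj₂ y) (decomp (proj₂ y) M′-matroid) B)) matroids) ⟩
  sumℚ L (λ y → proj₁ y * sumℚ (allFams n) (λ S → toℚ (p (proj₂ y) S) * boolℚ (memF B S)))
    ≡⟨ sumℚ-*-pairing L (allFams n) proj₁ (λ y S → toℚ (p (proj₂ y) S)) (λ S → boolℚ (memF B S)) ⟩
  sumℚ (allFams n) (λ S → sumℚ L (λ y → proj₁ y * toℚ (p (proj₂ y) S)) * boolℚ (memF B S))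
    ≡⟨ sumℚ-cong (allFams n) (λ S → cong (_* boolℚ (memF B S)) (Σtp≡p S)) ⟩
  sumℚ (allFams n) (λ S → toℚ (p M S) * boolℚ (memF B S))
    ≡⟨ decomposition-at-ind M (decomp M M-matroid) B ⟨
  boolℚ (memF B M) ∎

theorem4p2 : (r n : ℕ) → r ≤ n →
    (p : Fam n → Fam n → ℤ) →
    (∀ M → IsMatroid r n M → IsSchubertDecomp r n M (p M)) →
    ∀ M → IsMatroid r n M → IsVertex r n p M
theorem4p2 r n _ p decomp M M-matroid (L , properties , Σt≡1 , Σtp≡p) =
  let 0≤t = All.map (proj₁ ∘ proj₂) properties
      (_ , M′) , M′∈L , 0<t = positive-weight L proj₁ 0≤t Σt≡1
      _ , _ , S , p[M′]S≢p[M]S = All.lookup properties M′∈L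
      same-bases = λ B → boolℚ-extremal L proj₁ 0≤t Σt≡1 (memF B ∘ proj₂) (memF B M)
        (bases-of-combination p decomp M-matroid L (All.map proj₁ properties) Σtp≡p B) M′∈L 0<t
  in  p[M′]S≢p[M]S (cong (λ F → p F S) (memF-ext M′ M same-bases))
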